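{- For all positive integers $k$ and $m$, every finite graph $G$ has a set $S\subseteq V(G)$ with $|S|\leq (k-1)m$ such that, letting $C_1,\dots,C_t$ be the connected components of $G\setminus S$, one of the following holds: (a) $t\geq m$; (b) each $C_i$ ($1\le i\le t$) is either $k$-connected or complete.
   Context: $G\setminus S$ denotes the induced subgraph of $G$ on $V(G)\setminus S$. -}

module Defs where

open import Data.Nat using (ℕ; suc; _<_)
open import Data.Bool using (Bool; true; false)
open import Data.Fin using (Fin)
open import Data.Fin.Subset using (Subset; _∈_; _∉_; ∣_∣)
open import Data.Product using (Σ; _×_)
open import Relation.Binary.PropositionalEquality using (_≡_; _≢_)
open import Relation.Nullary using (¬_)

record Graph (n : ℕ) : Set where
  field
    adj    : Fin n → Fin n → Bool
    sym    : ∀ u v → adj u v ≡ adj v u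
    irrefl : ∀ u → adj u u ≡ false

module _ {n : ℕ} (G : Graph n) where
  open Graph G

  Adj : Fin n → Fin n → Set
  Adj u v = adj u v ≡ true

  VSet : Set₁
  VSet = Fin n → Set

  data Path (T : VSet) : Fin n → Fin n → Set where
    here : ∀ {u} → T u → Path T u u
    step : ∀ {u w v} → T u → Adj u w → Path T w v → Path T u v

  Connected : VSet → Set
  Connected T = ∀ u v → T u → T v → Path T u v

  Complete : VSet → Set
  Complete T = ∀ u v → T u → T v → u ≢ v → Adj u v

  MoreThan : ℕ → VSet → Set
  MoreThan k T = Σ (Fin (suc k) → Fin n) λ f →
    (∀ i → T (f i)) × (∀ i j → f i ≡ f j → i ≡ j)

  Minus : VSet → Subset n → VSet
  Minus T X v = T v × v ∉ X

  -- G[T] is k-connected (Diestel): |T| > k and G[T] - X is connected for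
  -- every X ⊆ T with |X| < k.
  KConnected : ℕ → VSet → Set
  KConnected k T = MoreThan k T ×
    (∀ (X : Subset n) → (∀ v → v ∈ X → T v) → ∣ X ∣ < k → Connected (Minus T X))

  Outside : Subset n → VSet
  Outside S v = v ∉ S

  Comp : Subset n → Fin n → VSet
  Comp S v u = Path (Outside S) v u

  AtLeastComponents : Subset n → ℕ → Set
  AtLeastComponents S m = Σ (Fin m → Fin n) λ f →
    (∀ i → f i ∉ S) × (∀ i j → i ≢ j → ¬ Path (Outside S) (f i) (f j))

-- If some component C of G ∖ S is neither complete nor k-connected, then a set
-- X ⊆ C of fewer than k vertices disconnects C.  Moving X into S costs at most
-- k − 1 vertices and gains a component, so starting from S = ∅ this happens at
-- most m − 1 times before G ∖ S has m components.
module Submission where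

open import Defs
open import Data.Nat using (ℕ; zero; suc; _≤_; _<_; _∸_; _*_; _+_; z≤n; s≤s; _<?_)
open import Data.Nat.Properties
  using (≤-trans; ≤-reflexive; +-monoʳ-≤; +-mono-≤; *-monoʳ-≤; n≤1+n; m≤n⇒m≤o+n; ≮⇒≥;
         +-suc; +-comm; *-suc; suc[m]≤n⇒m≤pred[n]; pred[m∸n]≡m∸[1+n]; module ≤-Reasoning)
open import Data.Bool using (true; false)
import Data.Bool as Bool
open import Data.Fin using (Fin; zero; suc; inject≤; _≟_)
open import Data.Fin.Properties using (suc-injective; inject≤-injective; any?; all?; ∀-cons)
open import Data.Fin.Subset using (Subset; _∈_; _∉_; _∪_; ∣_∣; ⊥)
open import Data.Fin.Subset.Properties using (_∈?_; anySubset?; p⊆p∪q; q⊆p∪q; x∈p∪q⁻; ∉⊥; ∣⊥∣≡0)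
open import Data.List using (List; allFin)
import Data.List as List
open import Data.List.Membership.Propositional using () renaming (_∈_ to _∈ˡ_)
open import Data.List.Membership.Propositional.Properties using (∈-allFin)
import Data.List.Relation.Unary.Any as Any
open import Data.Product using (Σ; ∃; ∃-syntax; _×_; _,_; proj₁; proj₂)
open import Data.Sum using (_⊎_; inj₁; inj₂; [_,_])
import Data.Sum as Sum
open import Data.Vec using ([]; _∷_; here; there; tabulate)
open import Data.Vec.Properties using (lookup∘tabulate; lookup⇒[]=; []=⇒lookup)
open import Function using (_∘_)
open import Function.Definitions using (Injective)
open import Level using (Level)
open import Relation.Binary.PropositionalEquality using (_≡_; _≢_; refl; sym; trans; subst; cong)
open import Relation.Nullary using (¬_; Dec; yes; no; does; contradiction)
open import Relation.Nullary.Decidable using (map′; dec-true; _×-dec_; _⊎-dec_; ¬?; _→-dec_)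
open import Relation.Unary using (Pred; Decidable)

module _ {ℓ : Level} {n : ℕ} {P : Pred (Fin n) ℓ} (P? : Decidable P) where

  fromDecidable : Subset n
  fromDecidable = tabulate (does ∘ P?)

  ∈-fromDecidable⁺ : ∀ {y} → P y → y ∈ fromDecidable
  ∈-fromDecidable⁺ {y} py = lookup⇒[]= y _ (trans (lookup∘tabulate _ y) (dec-true (P? y) py))

  ∈-fromDecidable⁻ : ∀ {y} → y ∈ fromDecidable → P y
  ∈-fromDecidable⁻ {y} y∈ with P? y | trans (sym (lookup∘tabulate _ y)) ([]=⇒lookup y∈)
  ... | yes py | _  = py
  ... | no _   | ()

enumerate : ∀ {n} (p : Subset n) →
  Σ (Fin ∣ p ∣ → Fin n) λ f → (∀ i → f i ∈ p) × Injective _≡_ _≡_ f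
enumerate [] = (λ ()) , (λ ()) , λ {}
enumerate (false ∷ p) with enumerate p
... | f , f∈p , f-inj = suc ∘ f , there ∘ f∈p , f-inj ∘ suc-injective
enumerate (true ∷ p) with enumerate p
... | f , f∈p , f-inj = g , g∈p , g-inj
  where
  g : Fin (suc ∣ p ∣) → Fin _
  g zero    = zero
  g (suc i) = suc (f i)
  g∈p : ∀ i → g i ∈ true ∷ p
  g∈p zero    = here
  g∈p (suc i) = there (f∈p i)
  g-inj : Injective _≡_ _≡_ g
  g-inj {zero}  {zero}  _  = refl
  g-inj {suc i} {suc j} eq = cong suc (f-inj (suc-injective eq))

∣p∪q∣≤∣p∣+∣q∣ : ∀ {n} (p q : Subset n) → ∣ p ∪ q ∣ ≤ ∣ p ∣ + ∣ q ∣
∣p∪q∣≤∣p∣+∣q∣ []          []          = z≤n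
∣p∪q∣≤∣p∣+∣q∣ (true ∷ p)  (true ∷ q)  =
  s≤s (≤-trans (∣p∪q∣≤∣p∣+∣q∣ p q) (+-monoʳ-≤ ∣ p ∣ (n≤1+n ∣ q ∣)))
∣p∪q∣≤∣p∣+∣q∣ (true ∷ p)  (false ∷ q) = s≤s (∣p∪q∣≤∣p∣+∣q∣ p q)
∣p∪q∣≤∣p∣+∣q∣ (false ∷ p) (true ∷ q)  =
  ≤-trans (s≤s (∣p∪q∣≤∣p∣+∣q∣ p q)) (≤-reflexive (sym (+-suc ∣ p ∣ ∣ q ∣)))
∣p∪q∣≤∣p∣+∣q∣ (false ∷ p) (false ∷ q) = ∣p∪q∣≤∣p∣+∣q∣ p q

x∉p∪q⁺ : ∀ {n} {x : Fin n} {p q : Subset n} → x ∉ p → x ∉ q → x ∉ p ∪ q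
x∉p∪q⁺ {p = p} {q} x∉p x∉q = [ x∉p , x∉q ] ∘ x∈p∪q⁻ p q

all⊎any : ∀ {n p q} {P : Pred (Fin n) p} {Q : Pred (Fin n) q} →
  (∀ i → P i ⊎ Q i) → (∀ i → P i) ⊎ ∃ Q
all⊎any {zero}  _ = inj₁ λ ()
all⊎any {suc n} {P = P} {Q} h with h zero | all⊎any {P = P ∘ suc} {Q ∘ suc} (h ∘ suc)
... | inj₂ q₀ | _            = inj₂ (zero , q₀)
... | inj₁ _  | inj₂ (i , q) = inj₂ (suc i , q)
... | inj₁ p₀ | inj₁ ps      = inj₁ (∀-cons p₀ ps)

∣p∪q∣≤c*[1+j] : ∀ {n c j} (p q : Subset n) → ∣ p ∣ ≤ c * j → ∣ q ∣ ≤ c → ∣ p ∪ q ∣ ≤ c * suc j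
∣p∪q∣≤c*[1+j] {c = c} {j} p q ∣p∣≤ ∣q∣≤ = begin
  ∣ p ∪ q ∣      ≤⟨ ∣p∪q∣≤∣p∣+∣q∣ p q ⟩
  ∣ p ∣ + ∣ q ∣  ≤⟨ +-mono-≤ ∣p∣≤ ∣q∣≤ ⟩
  c * j + c      ≡⟨ +-comm (c * j) c ⟩
  c + c * j      ≡⟨ *-suc c j ⟨
  c * suc j      ∎
  where open ≤-Reasoning

<⇒≤∸1 : ∀ {m n} → m < n → m ≤ n ∸ 1
<⇒≤∸1 {m} {n} m<n = subst (m ≤_) (pred[m∸n]≡m∸[1+n] n 0) (suc[m]≤n⇒m≤pred[n] m<n)

module _ {n : ℕ} (G : Graph n) where
  open Graph G using (adj; irrefl)

  Adj-sym : ∀ {a b} → Adj G a b → Adj G b a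
  Adj-sym {a} {b} = trans (sym (Graph.sym G a b))

  ¬Adj-refl : ∀ {a} → ¬ Adj G a a
  ¬Adj-refl {a} e with trans (sym (irrefl a)) e
  ... | ()

  Adj? : ∀ a b → Dec (Adj G a b)
  Adj? a b = adj a b Bool.≟ true

  Path-mono : ∀ {T U} → (∀ y → T y → U y) → ∀ {a b} → Path G T a b → Path G U a b
  Path-mono T⊆U (here t)     = here (T⊆U _ t)
  Path-mono T⊆U (step t e p) = step (T⊆U _ t) e (Path-mono T⊆U p)

  Path-start : ∀ {T a b} → Path G T a b → T a
  Path-start (here t)     = t
  Path-start (step t _ _) = t

  Path-end : ∀ {T a b} → Path G T a b → T b
  Path-end (here t)     = t
  Path-end (step _ _ p) = Path-end p

  _++ᵖ_ : ∀ {T a b c} → Path G T a b → Path G T b c → Path G T a c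
  here _     ++ᵖ q = q
  step t e p ++ᵖ q = step t e (p ++ᵖ q)

  Path-snoc : ∀ {T a b c} → Path G T a b → Adj G b c → T c → Path G T a c
  Path-snoc p e t = p ++ᵖ step (Path-end p) e (here t)

  Path-reverse : ∀ {T a b} → Path G T a b → Path G T b a
  Path-reverse (here t)     = here t
  Path-reverse (step t e p) = Path-snoc (Path-reverse p) (Adj-sym e) t

  Without : VSet G → Fin n → VSet G
  Without T x y = T y × y ≢ x

  Path-through⁻ : ∀ {T} x {a b} → Path G T a b →
    Path G (Without T x) a b ⊎ (Path G T a x × Path G T x b)
  Path-through⁻ x {a} p@(here t) with a ≟ x
  ... | yes refl = inj₂ (p , p)
  ... | no a≢x   = inj₁ (here (t , a≢x))
  Path-through⁻ x {a} p@(step t e q) with a ≟ x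
  ... | yes refl = inj₂ (here t , p)
  ... | no a≢x with Path-through⁻ x q
  ...   | inj₁ q′        = inj₁ (step (t , a≢x) e q′)
  ...   | inj₂ (q₁ , q₂) = inj₂ (step t e q₁ , q₂)

  Path-through⁺ : ∀ {T} x {a b} →
    Path G (Without T x) a b ⊎ (Path G T a x × Path G T x b) → Path G T a b
  Path-through⁺ x (inj₁ p)         = Path-mono (λ _ → proj₁) p
  Path-through⁺ x (inj₂ (p₁ , p₂)) = p₁ ++ᵖ p₂

  EntersAt : VSet G → Fin n → Fin n → Set
  EntersAt T x a = a ≡ x ⊎ ∃[ w ] Path G (Without T x) a w × Adj G w x

  Path-into⁻ : ∀ {T x a} → Path G T a x → EntersAt T x a
  Path-into⁻ (here _) = inj₁ refl
  Path-into⁻ {x = x} {a} (step t e p) with a ≟ x | Path-into⁻ p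
  ... | yes a≡x | _                 = inj₁ a≡x
  ... | no a≢x  | inj₁ refl         = inj₂ (a , here (t , a≢x) , e)
  ... | no a≢x  | inj₂ (w , q , e′) = inj₂ (w , step (t , a≢x) e q , e′)

  Path-into⁺ : ∀ {T x a} → T x → EntersAt T x a → Path G T a x
  Path-into⁺ tx (inj₁ refl)        = here tx
  Path-into⁺ tx (inj₂ (w , p , e)) = Path-snoc (Path-mono (λ _ → proj₁) p) e tx

  -- Induction on a list covering T: a path either avoids its head x, or
  -- enters x from a path avoiding x and (reversed) likewise leaves it.
  Path?-covered : (xs : List (Fin n)) (T : VSet G) → Decidable T →
    (∀ y → T y → y ∈ˡ xs) → ∀ a b → Dec (Path G T a b)
  Path?-covered List.[] T T? T⊆xs a b = no λ p → ∉[] (T⊆xs a (Path-start p))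
    where
    ∉[] : ¬ a ∈ˡ List.[]
    ∉[] ()
  Path?-covered (x List.∷ xs) T T? T⊆xs a b =
    map′ (Path-through⁺ x) (Path-through⁻ x)
      (Path-x? a b ⊎-dec (into? a ×-dec map′ Path-reverse Path-reverse (into? b)))
    where
    T-x⊆xs : ∀ y → Without T x y → y ∈ˡ xs
    T-x⊆xs y (t , y≢x) with T⊆xs y t
    ... | Any.here y≡x = contradiction y≡x y≢x
    ... | Any.there y∈ = y∈
    Path-x? : ∀ a b → Dec (Path G (Without T x) a b)
    Path-x? = Path?-covered xs (Without T x) (λ y → T? y ×-dec ¬? (y ≟ x)) T-x⊆xs
    into? : ∀ a → Dec (Path G T a x)
    into? a = map′ (λ (tx , ent) → Path-into⁺ tx ent) (λ p → Path-end p , Path-into⁻ p)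
      (T? x ×-dec ((a ≟ x) ⊎-dec any? λ w → Path-x? a w ×-dec Adj? w x))

  Path? : (T : VSet G) → Decidable T → ∀ a b → Dec (Path G T a b)
  Path? T T? = Path?-covered (allFin n) T T? (λ y _ → ∈-allFin y)

  Comp? : ∀ S v → Decidable (Comp G S v)
  Comp? S v = Path? (Outside G S) (λ y → ¬? (y ∈? S)) v

  Minus? : ∀ {T} → Decidable T → ∀ X → Decidable (Minus G T X)
  Minus? T? X y = T? y ×-dec ¬? (y ∈? X)

  Disconnected : VSet G → Set
  Disconnected T = ∃[ a ] ∃[ b ] T a × T b × ¬ Path G T a b

  disconnected? : ∀ {T} → Decidable T → Dec (Disconnected T)
  disconnected? {T} T? = any? λ a → any? λ b → T? a ×-dec T? b ×-dec ¬? (Path? T T? a b)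

  ¬disconnected⇒connected : ∀ {T} → Decidable T → ¬ Disconnected T → Connected G T
  ¬disconnected⇒connected {T} T? ¬dis a b ta tb with Path? T T? a b
  ... | yes p = p
  ... | no ¬p = contradiction (a , b , ta , tb , ¬p) ¬dis

  ¬Path-nonadjacent : ∀ {T u w} → (∀ y → T y → y ≡ u ⊎ y ≡ w) → u ≢ w → ¬ Adj G u w →
    ¬ Path G T u w
  ¬Path-nonadjacent T⊆uw u≢w ¬e (here _) = u≢w refl
  ¬Path-nonadjacent T⊆uw u≢w ¬e (step _ e p) with T⊆uw _ (Path-start p)
  ... | inj₁ refl = ¬Adj-refl e
  ... | inj₂ refl = ¬e e

  moreThan-insert : ∀ {k T x} (X : Subset n) → (∀ y → y ∈ X → T y) → T x → x ∉ X → k ≤ ∣ X ∣ →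
    MoreThan G k T
  moreThan-insert {k} {T} {x} X X⊆T tx x∉X k≤∣X∣ = f , f∈T , f-inj
    where
    g = proj₁ (enumerate X)
    g∈X = proj₁ (proj₂ (enumerate X))
    g-inj = proj₂ (proj₂ (enumerate X))
    f : Fin (suc k) → Fin n
    f zero    = x
    f (suc i) = g (inject≤ i k≤∣X∣)
    f∈T : ∀ i → T (f i)
    f∈T zero    = tx
    f∈T (suc i) = X⊆T _ (g∈X _)
    f-inj : ∀ i j → f i ≡ f j → i ≡ j
    f-inj zero    zero    _  = refl
    f-inj zero    (suc j) eq = contradiction (subst (_∈ X) (sym eq) (g∈X _)) x∉X
    f-inj (suc i) zero    eq = contradiction (subst (_∈ X) eq (g∈X _)) x∉X
    f-inj (suc i) (suc j) eq = cong suc (inject≤-injective _ _ i j (g-inj eq))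

  Separator : ℕ → VSet G → Subset n → Set
  Separator k C X = (∀ y → y ∈ X → C y) × ∣ X ∣ < k × Disconnected (Minus G C X)

  separator? : ∀ k {C} → Decidable C → ∀ X → Dec (Separator k C X)
  separator? k C? X =
    all? (λ y → y ∈? X →-dec C? y) ×-dec ∣ X ∣ <? k ×-dec disconnected? (Minus? C? X)

  -- If no small separator exists and C is not complete, pick non-adjacent
  -- u, w: then C ∖ {u, w} would separate them unless it has at least k elements.
  trichotomy : ∀ k {C} → Decidable C →
    (KConnected G k C ⊎ Complete G C) ⊎ ∃ (Separator k C)
  trichotomy k {C} C? with anySubset? (separator? k C?)
  ... | yes sep = inj₂ sep
  ... | no ¬sep with any? (λ u → any? λ w → C? u ×-dec C? w ×-dec ¬? (u ≟ w) ×-dec ¬? (Adj? u w))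
  ...   | no ¬gap = inj₁ (inj₂ complete)
    where
    complete : Complete G C
    complete u w cu cw u≢w with Adj? u w
    ... | yes e  = e
    ... | no ¬e = contradiction (u , w , cu , cw , u≢w , ¬e) ¬gap
  ...   | yes (u , w , cu , cw , u≢w , ¬e) = inj₁ (inj₁ (moreThan-insert Rest Rest⊆C cu u∉Rest k≤∣Rest∣ , connected))
    where
    Rest? : Decidable λ y → C y × y ≢ u × y ≢ w
    Rest? y = C? y ×-dec ¬? (y ≟ u) ×-dec ¬? (y ≟ w)
    Rest : Subset n
    Rest = fromDecidable Rest?
    Rest⊆C : ∀ y → y ∈ Rest → C y
    Rest⊆C y = proj₁ ∘ ∈-fromDecidable⁻ Rest?
    u∉Rest : u ∉ Rest
    u∉Rest u∈ = contradiction refl (proj₁ (proj₂ (∈-fromDecidable⁻ Rest? u∈)))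
    w∉Rest : w ∉ Rest
    w∉Rest w∈ = contradiction refl (proj₂ (proj₂ (∈-fromDecidable⁻ Rest? w∈)))
    only-u-w : ∀ y → Minus G C Rest y → y ≡ u ⊎ y ≡ w
    only-u-w y (cy , y∉Rest) with y ≟ u | y ≟ w
    ... | yes y≡u | _       = inj₁ y≡u
    ... | no _    | yes y≡w = inj₂ y≡w
    ... | no y≢u  | no y≢w  = contradiction (∈-fromDecidable⁺ Rest? (cy , y≢u , y≢w)) y∉Rest
    k≤∣Rest∣ : k ≤ ∣ Rest ∣
    k≤∣Rest∣ = ≮⇒≥ λ ∣Rest∣<k → ¬sep (Rest , Rest⊆C , ∣Rest∣<k ,
      u , w , (cu , u∉Rest) , (cw , w∉Rest) , ¬Path-nonadjacent only-u-w u≢w ¬e)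
    connected : ∀ X → (∀ y → y ∈ X → C y) → ∣ X ∣ < k → Connected G (Minus G C X)
    connected X X⊆C ∣X∣<k =
      ¬disconnected⇒connected (Minus? C? X) λ dis → ¬sep (X , X⊆C , ∣X∣<k , dis)

  -- The separated vertices u, w become two representatives; the old
  -- representative of C (if any) is dropped in favour of them.
  separator-splits : ∀ {k j S v X} → Separator k (Comp G S v) X →
    AtLeastComponents G S (suc j) → AtLeastComponents G (S ∪ X) (suc (suc j))
  separator-splits {S = S} {v} {X} (X⊆C , _ , u , w , (cu , u∉X) , (cw , w∉X) , ¬u⇝w) (r , r∉S , r-sep) =
    r′ , r′∉S∪X , r′-sep
    where
    C = Comp G S v
    ∉S : ∀ {y} → y ∉ S ∪ X → y ∉ S
    ∉S y∉ = y∉ ∘ p⊆p∪q X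
    ∉X : ∀ {y} → y ∉ S ∪ X → y ∉ X
    ∉X y∉ = y∉ ∘ q⊆p∪q S X
    Path-weaken : ∀ {a b} → Path G (Outside G (S ∪ X)) a b → Path G (Outside G S) a b
    Path-weaken = Path-mono λ _ → ∉S
    stays-in-C : ∀ {a b} → C a → Path G (Outside G (S ∪ X)) a b → Path G (Minus G C X) a b
    stays-in-C ca (here t)     = here (ca , ∉X t)
    stays-in-C ca (step t e p) = step (ca , ∉X t) e (stays-in-C (Path-snoc ca e (∉S (Path-start p))) p)
    leaves-C : ∀ {a b} → C a → ¬ C b → ¬ Path G (Outside G (S ∪ X)) a b
    leaves-C ca ¬cb p = ¬cb (ca ++ᵖ Path-weaken p)
    same-rep : ∀ {i i′} → C (r i) → C (r i′) → i ≡ i′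
    same-rep {i} {i′} ci ci′ with i ≟ i′
    ... | yes i≡i′ = i≡i′
    ... | no i≢i′  = contradiction (Path-reverse ci ++ᵖ ci′) (r-sep i i′ i≢i′)
    replace : ∀ {y} → Dec (C y) → Fin n
    replace     (yes _) = w
    replace {y} (no _)  = y
    r′ : Fin (suc (suc _)) → Fin n
    r′ zero    = u
    r′ (suc i) = replace (Comp? S v (r i))
    replace-∉ : ∀ i (d : Dec (C (r i))) → replace d ∉ S ∪ X
    replace-∉ i (yes _)  = x∉p∪q⁺ (Path-end cw) w∉X
    replace-∉ i (no ¬ci) = x∉p∪q⁺ (r∉S i) (¬ci ∘ X⊆C _)
    u↮replace : ∀ i (d : Dec (C (r i))) → ¬ Path G (Outside G (S ∪ X)) u (replace d)
    u↮replace i (yes _)  = ¬u⇝w ∘ stays-in-C cu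
    u↮replace i (no ¬ci) = leaves-C cu ¬ci
    replace↮replace : ∀ i i′ → i ≢ i′ → (d : Dec (C (r i))) (d′ : Dec (C (r i′))) →
      ¬ Path G (Outside G (S ∪ X)) (replace d) (replace d′)
    replace↮replace i i′ i≢i′ (yes ci) (yes ci′) = contradiction (same-rep ci ci′) i≢i′
    replace↮replace i i′ i≢i′ (yes _)  (no ¬ci′) = leaves-C cw ¬ci′
    replace↮replace i i′ i≢i′ (no ¬ci) (yes _)   = leaves-C cw ¬ci ∘ Path-reverse
    replace↮replace i i′ i≢i′ (no _)   (no _)    = r-sep i i′ i≢i′ ∘ Path-weaken
    r′∉S∪X : ∀ i → r′ i ∉ S ∪ X
    r′∉S∪X zero    = x∉p∪q⁺ (Path-end cu) u∉X
    r′∉S∪X (suc i) = replace-∉ i _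
    r′-sep : ∀ i i′ → i ≢ i′ → ¬ Path G (Outside G (S ∪ X)) (r′ i) (r′ i′)
    r′-sep zero    zero     i≢i′ = contradiction refl i≢i′
    r′-sep zero    (suc i)  _    = u↮replace i _
    r′-sep (suc i) zero     _    = u↮replace i _ ∘ Path-reverse
    r′-sep (suc i) (suc i′) i≢i′ = replace↮replace i i′ (i≢i′ ∘ cong suc) _ _

  module _ (k : ℕ) where

    GoodComponents : Subset n → Set
    GoodComponents S = ∀ v → v ∉ S → KConnected G k (Comp G S v) ⊎ Complete G (Comp G S v)

    Decomposition : ℕ → Set
    Decomposition m = Σ (Subset n) λ S → ∣ S ∣ ≤ (k ∸ 1) * m ×
      (AtLeastComponents G S m ⊎ GoodComponents S)

    good-or-separable : ∀ S → GoodComponents S ⊎ ∃[ v ] ∃ (Separator k (Comp G S v))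
    good-or-separable S = all⊎any λ v → Sum.map₁ (λ good _ → good) (trichotomy k (Comp? S v))

    grow : ∀ d {j S} → ∣ S ∣ ≤ (k ∸ 1) * j → AtLeastComponents G S (suc j) →
      Decomposition (d + suc j)
    grow zero {j} {S} ∣S∣≤ comps =
      S , ≤-trans ∣S∣≤ (*-monoʳ-≤ (k ∸ 1) (n≤1+n j)) , inj₁ comps
    grow (suc d) {j} {S} ∣S∣≤ comps with good-or-separable S
    ... | inj₁ good =
      S , ≤-trans ∣S∣≤ (*-monoʳ-≤ (k ∸ 1) (m≤n⇒m≤o+n (suc d) (n≤1+n j))) , inj₂ good
    ... | inj₂ (v , X , sep@(_ , ∣X∣<k , _)) =
      subst Decomposition (+-suc d (suc j))
        (grow d (∣p∪q∣≤c*[1+j] S X ∣S∣≤ (<⇒≤∸1 ∣X∣<k)) (separator-splits sep comps))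

lemma5p4 : (k m : ℕ) → 1 ≤ k → 1 ≤ m → (n : ℕ) (G : Graph n) →
    Σ (Subset n) λ S → ∣ S ∣ ≤ (k ∸ 1) * m ×
      (AtLeastComponents G S m ⊎
        (∀ v → v ∉ S → KConnected G k (Comp G S v) ⊎ Complete G (Comp G S v)))
lemma5p4 k zero    _ () n G
lemma5p4 k (suc m) _ _ zero    G = ⊥ , z≤n , inj₂ λ ()
lemma5p4 k (suc m) _ _ (suc n) G =
  subst (Decomposition G k) (+-comm m 1) (grow G k m ∣⊥∣≤ one-component)
  where
  ∣⊥∣≤ : ∣ ⊥ {suc n} ∣ ≤ (k ∸ 1) * 0
  ∣⊥∣≤ = ≤-trans (≤-reflexive (∣⊥∣≡0 (suc n))) z≤n
  one-component : AtLeastComponents G ⊥ 1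
  one-component = (λ _ → zero) , (λ _ → ∉⊥) , λ { zero zero 0≢0 → contradiction refl 0≢0 }
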